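{- Let $\alpha$ be a positive rational number. If $\mathcal T_1$ and $\mathcal T_2$ are maximal primitive factorization trees for $\alpha$, then $\mathcal T_1\cong\mathcal T_2$.
   Context: Write $\alpha=a/b$ with $a,b$ coprime positive integers. Let $p_1\ge\cdots\ge p_N$ be the primes dividing $ab$, listed with multiplicity. Put $\gamma(i)=1$ if $p_i\mid a$, $\gamma(i)=-1$ if $p_i\mid b$, and $\alpha_n=\prod_{i=1}^n p_i^{\gamma(i)}$ for $0\le n\le N$. A factorization of a positive rational $\beta$ is a sequence $(a_1/b_1,a_2/b_2,\dots)$ with $a_i,b_i$ positive integers, $a_i=b_i=1$ for all but finitely many $i$, $\prod_i a_i/b_i=\beta$, $\max\{a_i,b_i\}\ge\max\{a_{i+1},b_{i+1}\}$ for all $i$, and $\gcd(a_i,b_j)=1$ for all $i,j$. Let $\mathfrak F_\alpha$ be the set of factorizations of $\alpha_n$, $0\le n\le N$. For $0\le n<N$, a factorization $(a_i/b_i)$ of $\alpha_n$ is a direct subfactorization of a factorization $(c_i/d_i)$ of $\alpha_{n+1}$ if either $p_{n+1}\mid a$ and for some $k$: $d_i=b_i$ for all $i$, $c_i=a_i$ for $i\ne k$, $c_k=a_kp_{n+1}$; or $p_{n+1}\mid b$ and for some $k$: $c_i=a_i$ for all $i$, $d_i=b_i$ for $i\ne k$, $d_k=b_kp_{n+1}$. A tree data structure for a set $X$ is a pair $(T,\nu)$ with $T$ a rooted tree (digraph with edges from each vertex to its children) and $\nu:V(T)\to X$ a map; $\phi$ is the parenting map and $\mathcal C(r)$ the set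 of children of $r$. A factorization tree for $\alpha$ is a tree data structure $(T,\nu)$ for $\mathfrak F_\alpha$ with: (1) root $r_0$ has $\nu(r_0)=(1,1,\dots)$; (2) if $n<N$ and $\nu(r)$ is a factorization of $\alpha_n$ then $r$ has a child; (3) $\nu(r)=\nu(s)$ and $\phi(r)=\phi(s)$ imply $r=s$; (4) for non-root $r$, $\nu(\phi(r))$ is a direct subfactorization of $\nu(r)$. For $0\le n<N$ and a factorization $\mathbf A=(a_1/b_1,\dots,a_\ell/b_\ell,1,1,\dots)$ of $\alpha_n$ with $a_\ell/b_\ell\ne1$ (with $\ell=0$ if $\mathbf A=(1,1,\dots)$): if $p_{n+1}\mid a$, let $\delta(\mathbf A)$ be the set of sequences obtained from $\mathbf A$ by replacing the entry $a_k/b_k$ by $a_kp_{n+1}/b_k$ for some index $k$ with $a_kp_{n+1}<b_k$, and let $\epsilon(\mathbf A)=\{(a_1/b_1,\dots,a_\ell/b_\ell,p_{n+1}/1,1,1,\dots)\}$; if $p_{n+1}\mid b$, let $\delta(\mathbf A)$ consist of the sequences obtained by replacing $a_k/b_k$ by $a_k/(b_kp_{n+1})$ for some $k$ with $b_kp_{n+1}<a_k$, and $\epsilon(\mathbf A)=\{(a_1/b_1,\dots,a_\ell/b_\ell,1/p_{n+1},1,1,\dots)\}$. Set $\Delta(\mathbf A)=\delta(\mathbf A)\cup\epsilon(\mathbf A)$. A maximal primitive factorization tree for $\alpha$ is a factorization tree $(T,\nu)$ for $\alpha$ such that $\nu(\mathcal C(r))=\Delta(\nu(r))$ for every non-leaf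 vertex $r$. An isomorphism $(T_1,\nu_1)\to(T_2,\nu_2)$ is a bijection $\sigma:V(T_1)\to V(T_2)$ with $\nu_2\circ\sigma=\nu_1$ and $(g,h)\in E(T_1)\iff(\sigma(g),\sigma(h))\in E(T_2)$; $\cong$ means an isomorphism exists. -}

module Defs where

open import Data.Nat using (ℕ; zero; suc; _+_; _*_; _≤_; _<_; _⊔_)
open import Data.Nat.Divisibility using (_∣_; _∣?_)
open import Data.Nat.Coprimality using (Coprime)
open import Data.Product using (Σ; ∃; ∃-syntax; _×_; _,_; proj₁; proj₂)
open import Data.Sum using (_⊎_)
open import Data.Bool using (if_then_else_)
open import Relation.Nullary using (¬_; does)
open import Relation.Binary.PropositionalEquality using (_≡_; _≢_)
open import Function.Definitions using (Bijective)

-- Sequences of pairs (a_i , b_i) standing for a_i / b_i, indexed from 0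
-- (index i here = index i+1 in the paper).

Seq : Set
Seq = ℕ → ℕ × ℕ

_≈ₛ_ : Seq → Seq → Set
f ≈ₛ g = ∀ i → f i ≡ g i

one : ℕ × ℕ
one = 1 , 1

prodUpTo : (ℕ → ℕ) → ℕ → ℕ
prodUpTo h zero    = 1
prodUpTo h (suc K) = prodUpTo h K * h K

maxP : ℕ × ℕ → ℕ
maxP x = proj₁ x ⊔ proj₂ x

-- f is a factorization of the positive rational β = proj₁ β / proj₂ β
-- (equality of rationals expressed by cross-multiplication).
IsFactorization : ℕ × ℕ → Seq → Set
IsFactorization β f =
    (∀ i → 1 ≤ proj₁ (f i) × 1 ≤ proj₂ (f i))
  × (∃[ K ] ((∀ i → K ≤ i → f i ≡ one)
            × prodUpTo (λ i → proj₁ (f i)) K * proj₂ β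
              ≡ proj₁ β * prodUpTo (λ i → proj₂ (f i)) K))
  × (∀ i → maxP (f (suc i)) ≤ maxP (f i))
  × (∀ i j → Coprime (proj₁ (f i)) (proj₂ (f j)))

data Path {V : Set} (E : V → V → Set) : V → V → Set where
  here : ∀ {v} → Path E v v
  step : ∀ {u v w} → Path E u v → E v w → Path E u w

record RootedTree : Set₁ where
  field
    V              : Set
    root           : V
    E              : V → V → Set
    root-no-parent : ∀ v → ¬ E v root
    unique-parent  : ∀ {u w v} → E u v → E w v → u ≡ w
    reachable      : ∀ v → Path E root v

record TreeDS (X : Seq → Set) : Set₁ where
  field
    T  : RootedTree
  open RootedTree T public
  field
    ν  : V → Seq
    ν∈ : ∀ v → X (ν v)

record _≅_ {X : Seq → Set} (T₁ T₂ : TreeDS X) : Set where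
  private
    module A = TreeDS T₁
    module B = TreeDS T₂
  field
    σ       : A.V → B.V
    σ-bij   : Bijective _≡_ _≡_ σ
    σ-ν     : ∀ g → B.ν (σ g) ≈ₛ A.ν g
    σ-edge  : ∀ g h → A.E g h → B.E (σ g) (σ h)
    σ-edge⁻ : ∀ g h → B.E (σ g) (σ h) → A.E g h

-- Everything depending on α = a/b and its prime list p_1 ≥ ⋯ ≥ p_N.
-- The prime p_{i+1} of the paper is  p i  here (i < N).

module Setup (a b N : ℕ) (p : ℕ → ℕ) where

  prodIf : ℕ → ℕ → ℕ
  prodIf d zero    = 1
  prodIf d (suc n) = if does (p n ∣? d) then prodIf d n * p n else prodIf d n

  α : ℕ → ℕ × ℕ
  α n = prodIf a n , prodIf b n

  Inℱ : Seq → Set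
  Inℱ f = ∃[ n ] (n ≤ N × IsFactorization (α n) f)

  DirectSub : ℕ → Seq → Seq → Set
  DirectSub n f g =
      n < N × IsFactorization (α n) f × IsFactorization (α (suc n)) g
    × ( (p n ∣ a × ∃[ k ] ( (∀ i → proj₂ (g i) ≡ proj₂ (f i))
                          × (∀ i → i ≢ k → proj₁ (g i) ≡ proj₁ (f i))
                          × proj₁ (g k) ≡ proj₁ (f k) * p n))
      ⊎ (p n ∣ b × ∃[ k ] ( (∀ i → proj₁ (g i) ≡ proj₁ (f i))
                          × (∀ i → i ≢ k → proj₂ (g i) ≡ proj₂ (f i))
                          × proj₂ (g k) ≡ proj₂ (f k) * p n)))

  -- ℓ is the length of the nontrivial prefix of f (0-based: f ℓ is the
  -- first entry equal to 1, and all later ones are 1)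
  IsLen : Seq → ℕ → Set
  IsLen f ℓ = (∀ i → ℓ ≤ i → f i ≡ one)
            × (ℓ ≡ 0 ⊎ ∃[ m ] (ℓ ≡ suc m × f m ≢ one))

  InΔ : ℕ → Seq → Seq → Set
  InΔ n f g =
      (p n ∣ a ×
        ( (∃[ k ] ( proj₁ (f k) * p n < proj₂ (f k)
                  × g k ≡ (proj₁ (f k) * p n , proj₂ (f k))
                  × (∀ i → i ≢ k → g i ≡ f i)))
        ⊎ (∃[ ℓ ] ( IsLen f ℓ × g ℓ ≡ (p n , 1)
                  × (∀ i → i ≢ ℓ → g i ≡ f i)))))
    ⊎ (p n ∣ b ×
        ( (∃[ k ] ( proj₂ (f k) * p n < proj₁ (f k)
                  × g k ≡ (proj₁ (f k) , proj₂ (f k) * p n)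
                  × (∀ i → i ≢ k → g i ≡ f i)))
        ⊎ (∃[ ℓ ] ( IsLen f ℓ × g ℓ ≡ (1 , p n)
                  × (∀ i → i ≢ ℓ → g i ≡ f i)))))

  Tree : Set₁
  Tree = TreeDS Inℱ

  record IsFactorizationTree (𝒯 : Tree) : Set where
    open TreeDS 𝒯
    field
      root-one    : ν root ≈ₛ (λ _ → one)
      has-child   : ∀ r n → n < N → IsFactorization (α n) (ν r) → ∃[ s ] E r s
      distinct    : ∀ q r s → E q r → E q s → ν r ≈ₛ ν s → r ≡ s
      parent-sub  : ∀ s r → E s r → ∃[ n ] DirectSub n (ν s) (ν r)

  record IsMaxPrimTree (𝒯 : Tree) : Set where
    open TreeDS 𝒯
    field
      isFT      : IsFactorizationTree 𝒯
      children⊆ : ∀ r n → n < N → IsFactorization (α n) (ν r) → (∃[ s ] E r s)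
                  → ∀ s → E r s → InΔ n (ν r) (ν s)
      children⊇ : ∀ r n → n < N → IsFactorization (α n) (ν r) → (∃[ s ] E r s)
                  → ∀ g → InΔ n (ν r) g → ∃[ s ] (E r s × ν s ≈ₛ g)

module Submission where

-- Two maximal primitive factorization trees for α are isomorphic
-- because in such a tree the labels of the children of a vertex are
-- determined by the label of the vertex itself: they form exactly the set
-- Δ(ν r).  Hence, starting from the roots (both labelled (1,1,…)), every edge
-- of one tree can be matched by an edge of the other with the same labels,
-- and the match is unique since siblings carry distinct labels.
--
-- A label- and edge-preserving endomorphism of a tree with
-- distinct sibling labels is the identity, so mutual simulations yield an
-- isomorphism.

open import Defs
open import Data.Nat using (ℕ; suc; _*_; _≤_; _<_)
open import Data.Nat.Primality using (Prime)
open import Data.Nat.Coprimality using (Coprime)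
open import Relation.Binary.PropositionalEquality
  using (_≡_; refl; sym; trans; cong; cong₂; subst; subst₂)
open import Data.Product using (Σ; _×_; _,_; proj₁; proj₂)
open import Data.Sum using (inj₁; inj₂)
open import Data.Empty using (⊥-elim)

≈ₛ-sym : ∀ {f g : Seq} → f ≈ₛ g → g ≈ₛ f
≈ₛ-sym e i = sym (e i)

≈ₛ-trans : ∀ {f g h : Seq} → f ≈ₛ g → g ≈ₛ h → f ≈ₛ h
≈ₛ-trans e e′ i = trans (e i) (e′ i)

module LabelledTrees {X : Seq → Set} where

  SiblingsDistinct : TreeDS X → Set
  SiblingsDistinct 𝒯 = ∀ q r s → E q r → E q s → ν r ≈ₛ ν s → r ≡ s
    where open TreeDS 𝒯

  record Simulates (𝒯₁ 𝒯₂ : TreeDS X) : Set where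
    private
      module A = TreeDS 𝒯₁
      module B = TreeDS 𝒯₂
    field
      root-match : B.ν B.root ≈ₛ A.ν A.root
      edge-match : ∀ {u₁ w₁} u₂ → B.ν u₂ ≈ₛ A.ν u₁ → A.E u₁ w₁ →
                   Σ B.V λ w₂ → B.E u₂ w₂ × B.ν w₂ ≈ₛ A.ν w₁

  -- A simulation into a tree with distinct sibling labels yields a root-,
  -- label- and edge-preserving map, obtained by following the root path.
  module Embedding (𝒯₁ 𝒯₂ : TreeDS X) (sim : Simulates 𝒯₁ 𝒯₂)
                   (distinct₂ : SiblingsDistinct 𝒯₂) where
    private
      module A = TreeDS 𝒯₁
      module B = TreeDS 𝒯₂
    open Simulates sim

    record Match (v : A.V) : Set where
      constructor matched
      field
        image : B.V
        label : B.ν image ≈ₛ A.ν v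
    open Match

    extend : ∀ {u w} → Match u → A.E u w → Match w
    extend m e = let (w₂ , _ , l) = edge-match (image m) (label m) e in matched w₂ l

    extend-edge : ∀ {u w} (m : Match u) (e : A.E u w) → B.E (image m) (image (extend m e))
    extend-edge m e = proj₁ (proj₂ (edge-match (image m) (label m) e))

    follow : ∀ {v} → Path A.E A.root v → Match v
    follow here       = matched B.root root-match
    follow (step P e) = extend (follow P) e

    sibling-unique : ∀ {x y w w′} → x ≡ y → B.E x w → B.E y w′ →
                     B.ν w ≈ₛ B.ν w′ → w ≡ w′
    sibling-unique refl e e′ l = distinct₂ _ _ _ e e′ l

    follow-unique : ∀ {v} (P Q : Path A.E A.root v) → image (follow P) ≡ image (follow Q)
    follow-unique here       here        = refl
    follow-unique here       (step Q e)  = ⊥-elim (A.root-no-parent _ e)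
    follow-unique (step P e) here        = ⊥-elim (A.root-no-parent _ e)
    follow-unique (step P e) (step Q e′) with A.unique-parent e e′
    ... | refl = sibling-unique (follow-unique P Q)
                   (extend-edge (follow P) e) (extend-edge (follow Q) e′)
                   (≈ₛ-trans (label (extend (follow P) e))
                             (≈ₛ-sym (label (extend (follow Q) e′))))

    σ : A.V → B.V
    σ v = image (follow (A.reachable v))

    σ-ν : ∀ v → B.ν (σ v) ≈ₛ A.ν v
    σ-ν v = label (follow (A.reachable v))

    σ-root : σ A.root ≡ B.root
    σ-root = follow-unique (A.reachable A.root) here

    σ-edge : ∀ g h → A.E g h → B.E (σ g) (σ h)
    σ-edge g h e = subst (B.E (σ g))
                     (sym (follow-unique (A.reachable h) (step (A.reachable g) e)))
                     (extend-edge (follow (A.reachable g)) e)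

  rigid : (𝒯 : TreeDS X) → SiblingsDistinct 𝒯 → let open TreeDS 𝒯 in
          (ρ : V → V) → ρ root ≡ root → (∀ v → ν (ρ v) ≈ₛ ν v) →
          (∀ g h → E g h → E (ρ g) (ρ h)) → ∀ v → ρ v ≡ v
  rigid 𝒯 distinct ρ ρ-root ρ-ν ρ-edge v = along (reachable v)
    where
    open TreeDS 𝒯
    along : ∀ {v} → Path E root v → ρ v ≡ v
    along here = ρ-root
    along (step {v = u} {w = w} P e) =
      distinct u (ρ w) w (subst (λ x → E x (ρ w)) (along P) (ρ-edge u w e)) e (ρ-ν w)

  mutual-simulation⇒≅ : (𝒯₁ 𝒯₂ : TreeDS X) →
    SiblingsDistinct 𝒯₁ → SiblingsDistinct 𝒯₂ →
    Simulates 𝒯₁ 𝒯₂ → Simulates 𝒯₂ 𝒯₁ → 𝒯₁ ≅ 𝒯₂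
  mutual-simulation⇒≅ 𝒯₁ 𝒯₂ distinct₁ distinct₂ sim₁₂ sim₂₁ = record
    { σ       = S.σ
    ; σ-bij   = injective , surjective
    ; σ-ν     = S.σ-ν
    ; σ-edge  = S.σ-edge
    ; σ-edge⁻ = λ g h e → subst₂ A.E (TS g) (TS h) (T.σ-edge _ _ e)
    }
    where
    module A = TreeDS 𝒯₁
    module S = Embedding 𝒯₁ 𝒯₂ sim₁₂ distinct₂
    module T = Embedding 𝒯₂ 𝒯₁ sim₂₁ distinct₁

    TS : ∀ v → T.σ (S.σ v) ≡ v
    TS = rigid 𝒯₁ distinct₁ (λ v → T.σ (S.σ v))
           (trans (cong T.σ S.σ-root) T.σ-root)
           (λ v → ≈ₛ-trans (T.σ-ν (S.σ v)) (S.σ-ν v))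
           (λ g h e → T.σ-edge _ _ (S.σ-edge g h e))

    ST : ∀ v → S.σ (T.σ v) ≡ v
    ST = rigid 𝒯₂ distinct₂ (λ v → S.σ (T.σ v))
           (trans (cong S.σ T.σ-root) S.σ-root)
           (λ v → ≈ₛ-trans (S.σ-ν (T.σ v)) (T.σ-ν v))
           (λ g h e → S.σ-edge _ _ (T.σ-edge g h e))

    injective : ∀ {x y} → S.σ x ≡ S.σ y → x ≡ y
    injective {x} {y} eq = trans (sym (TS x)) (trans (cong T.σ eq) (TS y))

    surjective : ∀ y → Σ A.V λ x → ∀ {z} → z ≡ x → S.σ z ≡ y
    surjective y = T.σ y , λ { refl → ST y }

prodUpTo-cong : ∀ {h h′ : ℕ → ℕ} → (∀ i → h i ≡ h′ i) → ∀ K → prodUpTo h K ≡ prodUpTo h′ K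
prodUpTo-cong e 0       = refl
prodUpTo-cong e (suc K) = cong₂ _*_ (prodUpTo-cong e K) (e K)

factorization-resp : ∀ β {f g : Seq} → f ≈ₛ g → IsFactorization β f → IsFactorization β g
factorization-resp β e (positive , (K , trivial-tail , product) , decreasing , coprime) =
    (λ i → subst (λ x → 1 ≤ proj₁ x × 1 ≤ proj₂ x) (e i) (positive i))
  , ( K
    , (λ i K≤i → trans (sym (e i)) (trivial-tail i K≤i))
    , subst₂ (λ u v → u * proj₂ β ≡ proj₁ β * v)
        (prodUpTo-cong (λ i → cong proj₁ (e i)) K)
        (prodUpTo-cong (λ i → cong proj₂ (e i)) K) product )
  , (λ i → subst₂ (λ x y → maxP x ≤ maxP y) (e (suc i)) (e i) (decreasing i))
  , (λ i j → subst₂ (λ x y → Coprime (proj₁ x) (proj₂ y)) (e i) (e j) (coprime i j))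

module MaximalPrimitive (a b N : ℕ) (p : ℕ → ℕ) where
  open Setup a b N p
  open LabelledTrees

  isLen-resp : ∀ {f f′ : Seq} {ℓ} → f ≈ₛ f′ → IsLen f ℓ → IsLen f′ ℓ
  isLen-resp e (tail , inj₁ ℓ≡0) = (λ i ℓ≤i → trans (sym (e i)) (tail i ℓ≤i)) , inj₁ ℓ≡0
  isLen-resp e (tail , inj₂ (m , ℓ≡1+m , fm≢1)) =
      (λ i ℓ≤i → trans (sym (e i)) (tail i ℓ≤i))
    , inj₂ (m , ℓ≡1+m , λ f′m≡1 → fm≢1 (trans (e m) f′m≡1))

  NumeratorStep DenominatorStep : ℕ → ℕ × ℕ → ℕ × ℕ → Set
  NumeratorStep   n x y = proj₁ x * p n < proj₂ x × y ≡ (proj₁ x * p n , proj₂ x)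
  DenominatorStep n x y = proj₂ x * p n < proj₁ x × y ≡ (proj₁ x , proj₂ x * p n)

  Δ-resp : ∀ n {f f′ g : Seq} → f ≈ₛ f′ → InΔ n f g → InΔ n f′ g
  Δ-resp n {g = g} e (inj₁ (p∣a , inj₁ (k , grows , gk , rest))) =
    let (grows′ , gk′) = subst (λ x → NumeratorStep n x (g k)) (e k) (grows , gk)
    in inj₁ (p∣a , inj₁ (k , grows′ , gk′ , λ i i≢k → trans (rest i i≢k) (e i)))
  Δ-resp n e (inj₁ (p∣a , inj₂ (ℓ , len , gℓ , rest))) =
    inj₁ (p∣a , inj₂ (ℓ , isLen-resp e len , gℓ , λ i i≢ℓ → trans (rest i i≢ℓ) (e i)))
  Δ-resp n {g = g} e (inj₂ (p∣b , inj₁ (k , grows , gk , rest))) =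
    let (grows′ , gk′) = subst (λ x → DenominatorStep n x (g k)) (e k) (grows , gk)
    in inj₂ (p∣b , inj₁ (k , grows′ , gk′ , λ i i≢k → trans (rest i i≢k) (e i)))
  Δ-resp n e (inj₂ (p∣b , inj₂ (ℓ , len , gℓ , rest))) =
    inj₂ (p∣b , inj₂ (ℓ , isLen-resp e len , gℓ , λ i i≢ℓ → trans (rest i i≢ℓ) (e i)))

  siblings-distinct : ∀ 𝒯 → IsMaxPrimTree 𝒯 → SiblingsDistinct 𝒯
  siblings-distinct 𝒯 M = IsFactorizationTree.distinct (IsMaxPrimTree.isFT M)

  -- Any maximal primitive factorization tree simulates any other: an edge
  -- u₁ → w₁ has ν w₁ ∈ Δ(ν u₁), and below an equally labelled u₂ the
  -- maximality of 𝒯₂ provides a child with label ν w₁.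
  maxPrim-simulates : ∀ 𝒯₁ 𝒯₂ → IsMaxPrimTree 𝒯₁ → IsMaxPrimTree 𝒯₂ → Simulates 𝒯₁ 𝒯₂
  maxPrim-simulates 𝒯₁ 𝒯₂ M₁ M₂ = record
    { root-match = ≈ₛ-trans F₂.root-one (≈ₛ-sym F₁.root-one)
    ; edge-match = edge-match
    }
    where
    module A = TreeDS 𝒯₁
    module B = TreeDS 𝒯₂
    module M₁ = IsMaxPrimTree M₁
    module M₂ = IsMaxPrimTree M₂
    module F₁ = IsFactorizationTree M₁.isFT
    module F₂ = IsFactorizationTree M₂.isFT

    edge-match : ∀ {u₁ w₁} u₂ → B.ν u₂ ≈ₛ A.ν u₁ → A.E u₁ w₁ →
                 Σ B.V λ w₂ → B.E u₂ w₂ × B.ν w₂ ≈ₛ A.ν w₁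
    edge-match {u₁} {w₁} u₂ same-label e with F₁.parent-sub u₁ w₁ e
    ... | n , n<N , fact₁ , _ , _ =
      M₂.children⊇ u₂ n n<N fact₂ (F₂.has-child u₂ n n<N fact₂) (A.ν w₁) w₁∈Δu₂
      where
      fact₂ : IsFactorization (α n) (B.ν u₂)
      fact₂ = factorization-resp (α n) (≈ₛ-sym same-label) fact₁
      w₁∈Δu₂ : InΔ n (B.ν u₂) (A.ν w₁)
      w₁∈Δu₂ = Δ-resp n (≈ₛ-sym same-label) (M₁.children⊆ u₁ n n<N fact₁ (w₁ , e) w₁ e)

theorem2p5 : (a b : ℕ) → 0 < a → 0 < b → Coprime a b →
    (N : ℕ) (p : ℕ → ℕ) →
    (∀ i → i < N → Prime (p i)) →
    (∀ i → suc i < N → p (suc i) ≤ p i) →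
    prodUpTo p N ≡ a * b →
    (𝒯₁ 𝒯₂ : Setup.Tree a b N p) →
    Setup.IsMaxPrimTree a b N p 𝒯₁ → Setup.IsMaxPrimTree a b N p 𝒯₂ →
    𝒯₁ ≅ 𝒯₂
theorem2p5 a b _ _ _ N p _ _ _ 𝒯₁ 𝒯₂ M₁ M₂ =
  LabelledTrees.mutual-simulation⇒≅ 𝒯₁ 𝒯₂
    (siblings-distinct 𝒯₁ M₁) (siblings-distinct 𝒯₂ M₂)
    (maxPrim-simulates 𝒯₁ 𝒯₂ M₁ M₂) (maxPrim-simulates 𝒯₂ 𝒯₁ M₂ M₁)
  where open MaximalPrimitive a b N p
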